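{- Let $S$ be a finite nonempty subset of $\mathbb{Z}^2$. Then $S$ is an antimatroidal point set if and only if $S$ is orthogonally convex, $N_4$-connected, and bounded by two monotone increasing $N_4$-paths between $(0,0)$ and $(x_{\max},y_{\max})$, i.e. $(0,0)\in S$ and each of $\mathcal{B}_{lower}$ and $\mathcal{B}_{upper}$, with its points listed in lexicographic order, is a monotone increasing $N_4$-path starting at $(0,0)$ and ending at $(x_{\max},y_{\max})$, where $x_{\max}$ and $y_{\max}$ are the maximum $x$- and $y$-coordinates of points of $S$.
   Context: A point $A=(x_A,y_A)\in\mathbb{Z}^2$ is regarded as a multiset over $\{x,y\}$ ($x_A$ copies of $x$, $y_A$ copies of $y$). Write $A\subseteq B$ if $x_A\le x_B$ and $y_A\le y_B$; $A\subset B$ if $A\subseteq B$ and $A\neq B$. A finite nonempty set $S\subseteq\mathbb{Z}^2$ is an antimatroidal point set if (A1) for every $(x_A,y_A)\in S$ with $(x_A,y_A)\neq(0,0)$, either $(x_A-1,y_A)\in S$ or $(x_A,y_A-1)\in S$; (A2) for all $A,B\in S$ with $A\not\subseteq B$: if $x_A\ge x_B$ and $y_A\ge y_B$ then $(x_B+1,y_B)\in S$ or $(x_B,y_B+1)\in S$; if $x_A\le x_B$ and $y_A\ge y_B$ then $(x_B,y_B+1)\in S$; if $x_A\ge x_B$ and $y_A\le y_B$ then $(x_B+1,y_B)\in S$. $N_4(x,y)=\{(x\pm1,y),(x,y\pm1)\}$. An $N_4$-path is a sequence $A_0,\dots,A_n$ with $A_i\in N_4(A_{i-1})$; it is monotone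 increasing if $A_i\subset A_{i+1}$ for all $i$. $S$ is $N_4$-connected if any two points of $S$ are joined by an $N_4$-path all of whose points lie in $S$. $S$ is orthogonally convex if for every horizontal or vertical line $L$, $S\cap L$ is empty, a point, or a set of consecutive lattice points on $L$. Lower and upper boundaries: $\mathcal{B}_{lower}=\{(x,y)\in S:(x+1,y)\notin S\ \vee\ (x,y-1)\notin S\ \vee\ (x+1,y-1)\notin S\}$, $\mathcal{B}_{upper}=\{(x,y)\in S:(x-1,y)\notin S\ \vee\ (x,y+1)\notin S\ \vee\ (x-1,y+1)\notin S\}$. -}

module Defs where

open import Data.Integer using (ℤ; +_; _+_; _-_; _≤_; _<_)
open import Data.Product using (_×_; _,_; proj₁; proj₂; Σ; ∃)
open import Data.Sum using (_⊎_)
open import Data.List using (List; []; _∷_; head; last)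
open import Data.List.Membership.Propositional using (_∈_)
open import Data.List.Relation.Unary.Linked using (Linked)
open import Data.Maybe using (just)
open import Relation.Nullary using (¬_)
open import Relation.Binary.PropositionalEquality using (_≡_; _≢_)

Point : Set
Point = ℤ × ℤ

xc yc : Point → ℤ
xc = proj₁
yc = proj₂

origin : Point
origin = (+ 0 , + 0)

-- A finite subset of ℤ² is represented by a list (duplicates/order irrelevant;
-- only membership _∈_ is ever used).
PointSet : Set
PointSet = List Point

-- Multiset inclusion A ⊆ B and strict inclusion A ⊂ B.
_⊆ₚ_ : Point → Point → Set
A ⊆ₚ B = xc A ≤ xc B × yc A ≤ yc B

_⊂ₚ_ : Point → Point → Set
A ⊂ₚ B = A ⊆ₚ B × A ≢ B

A1 : PointSet → Set
A1 S = ∀ A → A ∈ S → A ≢ origin →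
       ((xc A - + 1 , yc A) ∈ S) ⊎ ((xc A , yc A - + 1) ∈ S)

A2 : PointSet → Set
A2 S = ∀ A B → A ∈ S → B ∈ S → ¬ (A ⊆ₚ B) →
       ((xc A ≥' xc B) → (yc A ≥' yc B) →
          ((xc B + + 1 , yc B) ∈ S) ⊎ ((xc B , yc B + + 1) ∈ S))
     × ((xc A ≤ xc B) → (yc A ≥' yc B) → (xc B , yc B + + 1) ∈ S)
     × ((xc A ≥' xc B) → (yc A ≤ yc B) → (xc B + + 1 , yc B) ∈ S)
  where
  _≥'_ : ℤ → ℤ → Set
  a ≥' b = b ≤ a

Antimatroidal : PointSet → Set
Antimatroidal S = A1 S × A2 S

N4 : Point → Point → Set
N4 A B = (B ≡ (xc A + + 1 , yc A)) ⊎ (B ≡ (xc A - + 1 , yc A))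
       ⊎ (B ≡ (xc A , yc A + + 1)) ⊎ (B ≡ (xc A , yc A - + 1))

IsN4Path : List Point → Set
IsN4Path P = Linked (λ A B → N4 A B) P

IsMonotoneN4Path : List Point → Set
IsMonotoneN4Path P = Linked (λ A B → N4 A B × A ⊂ₚ B) P

FromTo : List Point → Point → Point → Set
FromTo P A B = head P ≡ just A × last P ≡ just B

AllIn : List Point → PointSet → Set
AllIn P S = ∀ A → A ∈ P → A ∈ S

N4Connected : PointSet → Set
N4Connected S = ∀ A B → A ∈ S → B ∈ S →
  Σ (List Point) λ P → IsN4Path P × FromTo P A B × AllIn P S

OrthConvex : PointSet → Set
OrthConvex S =
    (∀ a b k c → (a , c) ∈ S → (b , c) ∈ S → a ≤ k → k ≤ b → (k , c) ∈ S)
  × (∀ a b k c → (c , a) ∈ S → (c , b) ∈ S → a ≤ k → k ≤ b → (c , k) ∈ S)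

InLower : PointSet → Point → Set
InLower S (x , y) = (x , y) ∈ S ×
  (¬ ((x + + 1 , y) ∈ S) ⊎ ¬ ((x , y - + 1) ∈ S) ⊎ ¬ ((x + + 1 , y - + 1) ∈ S))

InUpper : PointSet → Point → Set
InUpper S (x , y) = (x , y) ∈ S ×
  (¬ ((x - + 1 , y) ∈ S) ⊎ ¬ ((x , y + + 1) ∈ S) ⊎ ¬ ((x - + 1 , y + + 1) ∈ S))

_<lex_ : Point → Point → Set
A <lex B = xc A < xc B ⊎ (xc A ≡ xc B × yc A < yc B)

IsLexListing : (Point → Set) → List Point → Set
IsLexListing Bd P = Linked _<lex_ P × (∀ A → (A ∈ P → Bd A) × (Bd A → A ∈ P))

IsMaxX IsMaxY : PointSet → ℤ → Set
IsMaxX S m = (∃ λ A → A ∈ S × xc A ≡ m) × (∀ A → A ∈ S → xc A ≤ m)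
IsMaxY S m = (∃ λ A → A ∈ S × yc A ≡ m) × (∀ A → A ∈ S → yc A ≤ m)

BoundaryIsPath : (Point → Set) → Point → Set
BoundaryIsPath Bd E = Σ (List Point) λ P →
  IsLexListing Bd P × IsMonotoneN4Path P × FromTo P origin E

BoundedByTwoMonotonePaths : PointSet → Set
BoundedByTwoMonotonePaths S = origin ∈ S ×
  (∀ xm ym → IsMaxX S xm → IsMaxY S ym →
     BoundaryIsPath (InLower S) (xm , ym) × BoundaryIsPath (InUpper S) (xm , ym))

-- (⇒) By A1 every point of S descends to the origin through S, which gives
-- N₄-connectivity; applied at a lexicographically least point it gives
-- (0,0) ∈ S and nonnegative coordinates. The last two clauses of A2 fill a
-- column (row) of S up to the height (width) of any point of S to its left
-- (below it): this is orthogonal convexity, and it makes the point of largest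
-- x + y dominate all of S. Each boundary is traced greedily from the origin,
-- the lower one stepping right when possible and up otherwise, the upper one up
-- when possible and right otherwise; every step lands on the boundary again and
-- below all later boundary points, so the walk lists the whole boundary.
-- (⇐) A point missing its lower neighbour lies on the lower path and its
-- predecessor there is a neighbour in S: this is A1. A point other than the top
-- missing its upper neighbour has a successor on the upper path: the first
-- clause of A2. For the other two clauses, the column (row) just beyond B is
-- crossed by the lower path below B and by the upper path above B, and
-- orthogonal convexity fills it in between.

module Submission where

open import Defs
open import Data.Empty using (⊥-elim)
open import Data.Integer using (ℤ; +_; _+_; _-_; _≤_; _<_; ∣_∣; -[1+_]; pred)
  renaming (suc to sucℤ)
import Data.Integer.Properties as ℤ
open import Data.Integer.Tactic.RingSolver using (solve-∀)
open import Data.List using (List; []; _∷_; head; last; filter)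
open import Data.List.Extrema ℤ.≤-totalOrder
  using (argmax; argmin; argmax-all; argmin-all; f[xs]≤f[argmax]; f[argmin]≤f[xs])
open import Data.List.Membership.Propositional using (_∈_; _∉_)
open import Data.List.Membership.Propositional.Properties using (∈-filter⁺; ∈-filter⁻)
open import Data.List.Relation.Unary.All as All using (All)
open import Data.List.Relation.Unary.Any using (here; there)
open import Data.List.Relation.Unary.Linked as Linked using (Linked; []; [-]; _∷_)
open import Data.Maybe using (just)
open import Data.Nat using (zero; suc)
open import Data.Product using (_×_; _,_; proj₁; proj₂; Σ; ∃; ∃-syntax)
open import Data.Product.Properties using (≡-dec)
open import Data.Sum using (_⊎_; inj₁; inj₂)
open import Data.Unit using (⊤; tt)
import Level
open import Function.Base using (_∘_)
open import Function.Bundles using (_⇔_; mk⇔)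
open import Relation.Nullary using (¬_; Dec; yes; no)
open import Relation.Nullary.Decidable using (_×-dec_)
open import Relation.Unary using (Pred; Decidable)
open import Relation.Binary.PropositionalEquality

private variable
  A B : Point
  i j : ℤ

-- Defs writes neighbours with i + + 1 and i - + 1, which are not
-- definitionally the library's sucℤ i = + 1 + i and pred i.

i+1≡suc[i] : ∀ i → i + + 1 ≡ sucℤ i
i+1≡suc[i] i = ℤ.+-comm i (+ 1)

i-1≡pred[i] : ∀ i → i - + 1 ≡ pred i
i-1≡pred[i] i = ℤ.+-comm i (-[1+ 0 ])

i+1-1≡i : ∀ i → i + + 1 - + 1 ≡ i
i+1-1≡i = solve-∀

i-1+1≡i : ∀ i → i - + 1 + + 1 ≡ i
i-1+1≡i = solve-∀

i<j⇒i+1≤j : i < j → i + + 1 ≤ j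
i<j⇒i+1≤j {i} rewrite i+1≡suc[i] i = ℤ.i<j⇒suc[i]≤j

i<j⇒i≤j-1 : i < j → i ≤ j - + 1
i<j⇒i≤j-1 {j = j} rewrite i-1≡pred[i] j = ℤ.i<j⇒i≤pred[j]

i<i+1 : ∀ i → i < i + + 1
i<i+1 i rewrite i+1≡suc[i] i = ℤ.suc[i]≤j⇒i<j ℤ.≤-refl

i-1<i : ∀ i → i - + 1 < i
i-1<i i rewrite i-1≡pred[i] i = ℤ.i≤pred[j]⇒i<j ℤ.≤-refl

i≤i+1 : ∀ i → i ≤ i + + 1
i≤i+1 i = ℤ.<⇒≤ (i<i+1 i)

i-1≤i : ∀ i → i - + 1 ≤ i
i-1≤i i = ℤ.<⇒≤ (i-1<i i)

i+1≰i : ¬ (i + + 1 ≤ i)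
i+1≰i {i} = ℤ.<⇒≱ (i<i+1 i)

i≰i-1 : ¬ (i ≤ i - + 1)
i≰i-1 {i} = ℤ.<⇒≱ (i-1<i i)

0≤i⇒i≡+∣i∣ : + 0 ≤ i → i ≡ + ∣ i ∣
0≤i⇒i≡+∣i∣ 0≤i = sym (ℤ.0≤i⇒+∣i∣≡i 0≤i)

interval-induction : (P : ℤ → Set) {a b : ℤ} → P a →
                     (∀ k → k < b → P k → P (k + + 1)) →
                     ∀ k → a ≤ k → k ≤ b → P k
interval-induction P {a} {b} Pa step k a≤k k≤b =
  subst P a+∣k-a∣≡k (from-a ∣ k - a ∣ (subst (_≤ b) (sym a+∣k-a∣≡k) k≤b))
  where
  cancel : ∀ a k → a + (k - a) ≡ k
  cancel = solve-∀
  shift : ∀ a n → (a + n) + + 1 ≡ a + (+ 1 + n)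
  shift = solve-∀

  a+∣k-a∣≡k : a + + ∣ k - a ∣ ≡ k
  a+∣k-a∣≡k = trans (cong (λ z → a + z) (ℤ.0≤i⇒+∣i∣≡i (ℤ.i≤j⇒0≤j-i a≤k))) (cancel a k)

  from-a : ∀ n → a + + n ≤ b → P (a + + n)
  from-a zero    _  = subst P (sym (ℤ.+-identityʳ a)) Pa
  from-a (suc n) ≤b = subst P (shift a (+ n)) (step (a + + n) a+n<b (from-a n (ℤ.<⇒≤ a+n<b)))
    where
    a+n<b : a + + n < b
    a+n<b = ℤ.<-≤-trans (subst (a + + n <_) (shift a (+ n)) (i<i+1 (a + + n))) ≤b

right up left down : Point → Point
right A = (xc A + + 1 , yc A)
up    A = (xc A , yc A + + 1)
left  A = (xc A - + 1 , yc A)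
down  A = (xc A , yc A - + 1)

left∘right : left (right A) ≡ A
left∘right {A} = cong (_, yc A) (i+1-1≡i (xc A))

right∘left : right (left A) ≡ A
right∘left {A} = cong (_, yc A) (i-1+1≡i (xc A))

down∘up : down (up A) ≡ A
down∘up {A} = cong (xc A ,_) (i+1-1≡i (yc A))

up∘down : up (down A) ≡ A
up∘down {A} = cong (xc A ,_) (i-1+1≡i (yc A))

_≟ₚ_ : (A B : Point) → Dec (A ≡ B)
_≟ₚ_ = ≡-dec ℤ._≟_ ℤ._≟_

open import Data.List.Membership.DecPropositional _≟ₚ_ using (_∈?_)

⊆ₚ-antisym : A ⊆ₚ B → B ⊆ₚ A → A ≡ B
⊆ₚ-antisym (x≤ , y≤) (x≥ , y≥) = cong₂ _,_ (ℤ.≤-antisym x≤ x≥) (ℤ.≤-antisym y≤ y≥)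

coordSum : Point → ℤ
coordSum A = xc A + yc A

coordSum-mono-⊂ : A ⊂ₚ B → coordSum A < coordSum B
coordSum-mono-⊂ {A} {B} ((x≤ , y≤) , A≢B) with xc A ℤ.≟ xc B | yc A ℤ.≟ yc B
... | yes x≡ | yes y≡ = ⊥-elim (A≢B (cong₂ _,_ x≡ y≡))
... | no x≢  | _      = ℤ.+-mono-<-≤ (ℤ.≤∧≢⇒< x≤ x≢) y≤
... | yes _  | no y≢  = ℤ.+-mono-≤-< x≤ (ℤ.≤∧≢⇒< y≤ y≢)

⊂ₚ⇒right⊆⊎above : A ⊂ₚ B → right A ⊆ₚ B ⊎ (xc B ≡ xc A × yc A < yc B)
⊂ₚ⇒right⊆⊎above {A} {B} ((x≤ , y≤) , A≢B) with xc B ℤ.≟ xc A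
... | no  xB≢xA = inj₁ (i<j⇒i+1≤j (ℤ.≤∧≢⇒< x≤ (xB≢xA ∘ sym)) , y≤)
... | yes xB≡xA = inj₂ (xB≡xA , ℤ.≤∧≢⇒< y≤ λ y≡ → A≢B (cong₂ _,_ (sym xB≡xA) y≡))

⊂ₚ⇒up⊆⊎beside : A ⊂ₚ B → up A ⊆ₚ B ⊎ (yc B ≡ yc A × xc A < xc B)
⊂ₚ⇒up⊆⊎beside {A} {B} ((x≤ , y≤) , A≢B) with yc B ℤ.≟ yc A
... | no  yB≢yA = inj₁ (x≤ , i<j⇒i+1≤j (ℤ.≤∧≢⇒< y≤ (yB≢yA ∘ sym)))
... | yes yB≡yA = inj₂ (yB≡yA , ℤ.≤∧≢⇒< x≤ λ x≡ → A≢B (cong₂ _,_ x≡ (sym yB≡yA)))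

sum-zero⇒origin : ∀ {x y} → + 0 ≤ x → + 0 ≤ y → x + y ≡ + 0 → (x , y) ≡ origin
sum-zero⇒origin {+ zero}  {+ zero}  _ _ _  = refl
sum-zero⇒origin {+ zero}  {+ suc _} _ _ ()
sum-zero⇒origin {+ suc _} {+ _}     _ _ ()

coordSum-origin≢suc : ∀ {n} → coordSum origin ≢ + suc n
coordSum-origin≢suc ()

coordSum-left : ∀ A → coordSum (left A) ≡ coordSum A - + 1
coordSum-left A = shift (xc A) (yc A)
  where
  shift : ∀ x y → (x - + 1) + y ≡ (x + y) - + 1
  shift = solve-∀

coordSum-down : ∀ A → coordSum (down A) ≡ coordSum A - + 1
coordSum-down A = sym (ℤ.+-assoc (xc A) (yc A) -[1+ 0 ])

MonotoneStep : Point → Point → Set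
MonotoneStep A B = N4 A B × A ⊂ₚ B

right-step : MonotoneStep A (right A)
right-step {A} = inj₁ refl , (i≤i+1 (xc A) , ℤ.≤-refl) , λ A≡ → i+1≰i (ℤ.≤-reflexive (cong xc (sym A≡)))

up-step : MonotoneStep A (up A)
up-step {A} = inj₂ (inj₂ (inj₁ refl)) , (ℤ.≤-refl , i≤i+1 (yc A)) , λ A≡ → i+1≰i (ℤ.≤-reflexive (cong yc (sym A≡)))

monotoneStep⇒right⊎up : MonotoneStep A B → B ≡ right A ⊎ B ≡ up A
monotoneStep⇒right⊎up (inj₁ B≡ , _)                            = inj₁ B≡
monotoneStep⇒right⊎up (inj₂ (inj₁ refl) , (x≤ , _) , _)         = ⊥-elim (i≰i-1 x≤)
monotoneStep⇒right⊎up (inj₂ (inj₂ (inj₁ B≡)) , _)               = inj₂ B≡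
monotoneStep⇒right⊎up (inj₂ (inj₂ (inj₂ refl)) , (_ , y≤) , _)  = ⊥-elim (i≰i-1 y≤)

monotoneStep⇒<lex : MonotoneStep A B → A <lex B
monotoneStep⇒<lex s with monotoneStep⇒right⊎up s
... | inj₁ refl = inj₁ (i<i+1 _)
... | inj₂ refl = inj₂ (refl , i<i+1 _)

coordSum-step : MonotoneStep A B → coordSum B ≡ coordSum A + + 1
coordSum-step {A} s with monotoneStep⇒right⊎up s
... | inj₁ refl = right-shift (xc A) (yc A)
  where
  right-shift : ∀ x y → (x + + 1) + y ≡ (x + y) + + 1
  right-shift = solve-∀
... | inj₂ refl = sym (ℤ.+-assoc (xc A) (yc A) (+ 1))

module _ (f : Point → ℤ) {P : Pred Point Level.zero} (P? : Decidable P)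
         {L : List Point} {a : Point} (a∈L : a ∈ L) (Pa : P a) where

  private
    candidates : List Point
    candidates = filter P? L

    candidates-valid : All (λ m → m ∈ L × P m) candidates
    candidates-valid = All.tabulate (∈-filter⁻ P?)

    candidate : ∀ {b} → b ∈ L → P b → b ∈ candidates
    candidate = ∈-filter⁺ P?

  maximiser-such-that : ∃[ m ] m ∈ L × P m × (∀ b → b ∈ L → P b → f b ≤ f m)
  maximiser-such-that = m , proj₁ m-valid , proj₂ m-valid ,
              λ b b∈L Pb → All.lookup (f[xs]≤f[argmax] a candidates) (candidate b∈L Pb)
    where
    m : Point
    m = argmax f a candidates
    m-valid : m ∈ L × P m
    m-valid = argmax-all f (a∈L , Pa) candidates-valid

  minimiser-such-that : ∃[ m ] m ∈ L × P m × (∀ b → b ∈ L → P b → f m ≤ f b)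
  minimiser-such-that = m , proj₁ m-valid , proj₂ m-valid ,
              λ b b∈L Pb → All.lookup (f[argmin]≤f[xs] a candidates) (candidate b∈L Pb)
    where
    m : Point
    m = argmin f a candidates
    m-valid : m ∈ L × P m
    m-valid = argmin-all f (a∈L , Pa) candidates-valid

module _ (f : Point → ℤ) {L : List Point} {a : Point} (a∈L : a ∈ L) where

  maximiser : ∃[ m ] m ∈ L × (∀ b → b ∈ L → f b ≤ f m)
  maximiser =
    let (m , m∈L , _ , m-max) = maximiser-such-that f {P = λ _ → ⊤} (λ _ → yes tt) a∈L tt
    in m , m∈L , λ b b∈L → m-max b b∈L tt

  minimiser : ∃[ m ] m ∈ L × (∀ b → b ∈ L → f m ≤ f b)
  minimiser =
    let (m , m∈L , _ , m-min) = minimiser-such-that f {P = λ _ → ⊤} (λ _ → yes tt) a∈L tt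
    in m , m∈L , λ b b∈L → m-min b b∈L tt

module _ {R : Point → Point → Set} where

  predecessor-in : ∀ {L h} → Linked R L → head L ≡ just h → A ∈ L → A ≢ h →
                   ∃[ B ] B ∈ L × R B A
  predecessor-in [-]     refl (here refl) A≢h = ⊥-elim (A≢h refl)
  predecessor-in (r ∷ l) refl (here refl) A≢h = ⊥-elim (A≢h refl)
  predecessor-in {A = A} (_∷_ {y = y} r l) refl (there A∈) _ with A ≟ₚ y
  ... | yes refl = _ , here refl , r
  ... | no A≢y   = let (B , B∈ , rBA) = predecessor-in l refl A∈ A≢y in B , there B∈ , rBA

  successor-in : ∀ {L e} → Linked R L → last L ≡ just e → A ∈ L → A ≢ e →
                 ∃[ B ] B ∈ L × R A B
  successor-in [-]     refl (here refl) A≢e = ⊥-elim (A≢e refl)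
  successor-in (r ∷ l) _    (here refl) _   = _ , there (here refl) , r
  successor-in (r ∷ l) e    (there A∈)  A≢e =
    let (B , B∈ , rAB) = successor-in l e A∈ A≢e in B , there B∈ , rAB

  module _ (f : Point → ℤ) (f-mono : ∀ {A B} → R A B → f A ≤ f B) where

    head-≤ : ∀ {L h} → Linked R L → head L ≡ just h → A ∈ L → f h ≤ f A
    head-≤ [-]     refl (here refl) = ℤ.≤-refl
    head-≤ (r ∷ l) refl (here refl) = ℤ.≤-refl
    head-≤ (r ∷ l) refl (there A∈)  = ℤ.≤-trans (f-mono r) (head-≤ l refl A∈)

  -- A discrete intermediate value theorem for a key f moving in unit steps;
  -- g locates the crossing relative to A.
  module Crossing (f g : Point → ℤ)
                  (f-step : ∀ {A B} → R A B → f B ≡ f A ⊎ f B ≡ f A + + 1)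
                  (g-mono : ∀ {A B} → R A B → g A ≤ g B) where

    private
      f-next : ∀ {A B c} → R A B → f A < c → f B ≤ c
      f-next r fA<c with f-step r
      ... | inj₁ fB≡ = subst (_≤ _) (sym fB≡) (ℤ.<⇒≤ fA<c)
      ... | inj₂ fB≡ = subst (_≤ _) (sym fB≡) (i<j⇒i+1≤j fA<c)

    crossing-after : ∀ {L e c} → Linked R L → last L ≡ just e → A ∈ L →
                     f A ≤ c → c ≤ f e → ∃[ B ] B ∈ L × f B ≡ c × g A ≤ g B
    crossing-after [-] refl (here refl) fA≤c c≤fe = _ , here refl , ℤ.≤-antisym fA≤c c≤fe , ℤ.≤-refl
    crossing-after {A = A} {c = c} (r ∷ l) e (here refl) fA≤c c≤fe with f A ℤ.≟ c
    ... | yes fA≡c = A , here refl , fA≡c , ℤ.≤-refl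
    ... | no fA≢c  =
      let (B , B∈ , fB≡c , g≤) = crossing-after l e (here refl) (f-next r (ℤ.≤∧≢⇒< fA≤c fA≢c)) c≤fe
      in B , there B∈ , fB≡c , ℤ.≤-trans (g-mono r) g≤
    crossing-after (r ∷ l) e (there A∈) fA≤c c≤fe =
      let (B , B∈ , fB≡c , g≤) = crossing-after l e A∈ fA≤c c≤fe in B , there B∈ , fB≡c , g≤

    crossing-before : ∀ {L h c} → Linked R L → head L ≡ just h → A ∈ L →
                      f h ≤ c → c ≤ f A → ∃[ B ] B ∈ L × f B ≡ c × g B ≤ g A
    crossing-before [-]     refl (here refl) fh≤c c≤fA = _ , here refl , ℤ.≤-antisym fh≤c c≤fA , ℤ.≤-refl
    crossing-before (r ∷ l) refl (here refl) fh≤c c≤fA = _ , here refl , ℤ.≤-antisym fh≤c c≤fA , ℤ.≤-refl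
    crossing-before {c = c} (_∷_ {x = h} r l) refl (there A∈) fh≤c c≤fA with f h ℤ.≟ c
    ... | yes fh≡c = h , here refl , fh≡c , head-≤ g g-mono (r ∷ l) refl (there A∈)
    ... | no fh≢c  =
      let (B , B∈ , fB≡c , g≤) = crossing-before l refl A∈ (f-next r (ℤ.≤∧≢⇒< fh≤c fh≢c)) c≤fA
      in B , there B∈ , fB≡c , g≤

xc-step : MonotoneStep A B → xc B ≡ xc A ⊎ xc B ≡ xc A + + 1
xc-step s with monotoneStep⇒right⊎up s
... | inj₁ refl = inj₂ refl
... | inj₂ refl = inj₁ refl

yc-step : MonotoneStep A B → yc B ≡ yc A ⊎ yc B ≡ yc A + + 1
yc-step s with monotoneStep⇒right⊎up s
... | inj₁ refl = inj₁ refl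
... | inj₂ refl = inj₂ refl

xc-mono : MonotoneStep A B → xc A ≤ xc B
xc-mono (_ , (x≤ , _) , _) = x≤

yc-mono : MonotoneStep A B → yc A ≤ yc B
yc-mono (_ , (_ , y≤) , _) = y≤

module ByColumn = Crossing xc yc xc-step yc-mono
module ByRow    = Crossing yc xc yc-step xc-mono

module BoundaryPath {Bd : Point → Set} {E : Point} (boundary : BoundaryIsPath Bd E) where

  path : List Point
  path = proj₁ boundary

  member : A ∈ path → Bd A
  member {A} = proj₁ (proj₂ (proj₁ (proj₂ boundary)) A)

  complete : Bd A → A ∈ path
  complete {A} = proj₂ (proj₂ (proj₁ (proj₂ boundary)) A)

  linked : Linked MonotoneStep path
  linked = proj₁ (proj₂ (proj₂ boundary))

  starts : head path ≡ just origin
  starts = proj₁ (proj₂ (proj₂ (proj₂ boundary)))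

  ends : last path ≡ just E
  ends = proj₂ (proj₂ (proj₂ (proj₂ boundary)))

  predecessor : A ∈ path → A ≢ origin → ∃[ B ] B ∈ path × MonotoneStep B A
  predecessor = predecessor-in linked starts

  successor : A ∈ path → A ≢ E → ∃[ B ] B ∈ path × MonotoneStep A B
  successor = successor-in linked ends

  0≤xc : A ∈ path → + 0 ≤ xc A
  0≤xc = head-≤ xc xc-mono linked starts

  0≤yc : A ∈ path → + 0 ≤ yc A
  0≤yc = head-≤ yc yc-mono linked starts

  column-after : ∀ {c} → A ∈ path → xc A ≤ c → c ≤ xc E → ∃[ y ] (c , y) ∈ path × yc A ≤ y
  column-after A∈ xA≤c c≤xE =
    let (B , B∈ , xB≡c , yA≤yB) = ByColumn.crossing-after linked ends A∈ xA≤c c≤xE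
    in yc B , subst (λ x → (x , yc B) ∈ path) xB≡c B∈ , yA≤yB

  column-before : ∀ {c} → A ∈ path → + 0 ≤ c → c ≤ xc A → ∃[ y ] (c , y) ∈ path × y ≤ yc A
  column-before A∈ 0≤c c≤xA =
    let (B , B∈ , xB≡c , yB≤yA) = ByColumn.crossing-before linked starts A∈ 0≤c c≤xA
    in yc B , subst (λ x → (x , yc B) ∈ path) xB≡c B∈ , yB≤yA

  row-after : ∀ {c} → A ∈ path → yc A ≤ c → c ≤ yc E → ∃[ x ] (x , c) ∈ path × xc A ≤ x
  row-after A∈ yA≤c c≤yE =
    let (B , B∈ , yB≡c , xA≤xB) = ByRow.crossing-after linked ends A∈ yA≤c c≤yE
    in xc B , subst (λ y → (xc B , y) ∈ path) yB≡c B∈ , xA≤xB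

  row-before : ∀ {c} → A ∈ path → + 0 ≤ c → c ≤ yc A → ∃[ x ] (x , c) ∈ path × x ≤ xc A
  row-before A∈ 0≤c c≤yA =
    let (B , B∈ , yB≡c , xB≤xA) = ByRow.crossing-before linked starts A∈ 0≤c c≤yA
    in xc B , subst (λ y → (xc B , y) ∈ path) yB≡c B∈ , xB≤xA

module _ {S : PointSet} {s : Point} (s∈S : s ∈ S) where

  maxX-exists : ∃ (IsMaxX S)
  maxX-exists =
    let (m , m∈S , m-max) = maximiser xc s∈S in xc m , (m , m∈S , refl) , m-max

  maxY-exists : ∃ (IsMaxY S)
  maxY-exists =
    let (m , m∈S , m-max) = maximiser yc s∈S in yc m , (m , m∈S , refl) , m-max

-- From the boundary paths to the antimatroid axioms

module FromBoundaries (S : PointSet) {s : Point} (s∈S : s ∈ S)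
                      (convex : OrthConvex S) (bounded : BoundedByTwoMonotonePaths S) where

  private
    xmax ymax : ℤ
    xmax = proj₁ (maxX-exists s∈S)
    ymax = proj₁ (maxY-exists s∈S)

    ≤xmax : A ∈ S → xc A ≤ xmax
    ≤xmax = proj₂ (proj₂ (maxX-exists s∈S)) _

    ≤ymax : A ∈ S → yc A ≤ ymax
    ≤ymax = proj₂ (proj₂ (maxY-exists s∈S)) _

    boundaries : BoundaryIsPath (InLower S) (xmax , ymax) × BoundaryIsPath (InUpper S) (xmax , ymax)
    boundaries = proj₂ bounded xmax ymax (proj₂ (maxX-exists s∈S)) (proj₂ (maxY-exists s∈S))

  module Lower = BoundaryPath (proj₁ boundaries)
  module Upper = BoundaryPath (proj₂ boundaries)

  lower⊆S : A ∈ Lower.path → A ∈ S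
  lower⊆S A∈ = proj₁ (Lower.member A∈)

  upper⊆S : A ∈ Upper.path → A ∈ S
  upper⊆S A∈ = proj₁ (Upper.member A∈)

  column-top : B ∈ S → ∃[ t ] (xc B , t) ∈ Upper.path × yc B ≤ t
  column-top {B} B∈S
    with maximiser-such-that yc (λ C → (xc C ℤ.≟ xc B) ×-dec (yc B ℤ.≤? yc C)) B∈S (refl , ℤ.≤-refl)
  ... | (_ , t) , T∈S , (refl , yB≤t) , T-max =
    t , Upper.complete (T∈S , inj₂ (inj₁ λ up∈S → i+1≰i (T-max _ up∈S (refl , ℤ.≤-trans yB≤t (i≤i+1 t))))) , yB≤t

  column-bottom : A ∈ S → ∃[ b ] (xc A , b) ∈ Lower.path × b ≤ yc A
  column-bottom {A} A∈S
    with minimiser-such-that yc (λ C → (xc C ℤ.≟ xc A) ×-dec (yc C ℤ.≤? yc A)) A∈S (refl , ℤ.≤-refl)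
  ... | (_ , b) , B∈S , (refl , b≤yA) , B-min =
    b , Lower.complete (B∈S , inj₂ (inj₁ λ down∈S → i≰i-1 (B-min _ down∈S (refl , ℤ.≤-trans (i-1≤i b) b≤yA)))) , b≤yA

  row-end : B ∈ S → ∃[ r ] (r , yc B) ∈ Lower.path × xc B ≤ r
  row-end {B} B∈S
    with maximiser-such-that xc (λ C → (yc C ℤ.≟ yc B) ×-dec (xc B ℤ.≤? xc C)) B∈S (refl , ℤ.≤-refl)
  ... | (r , _) , R∈S , (refl , xB≤r) , R-max =
    r , Lower.complete (R∈S , inj₁ λ right∈S → i+1≰i (R-max _ right∈S (refl , ℤ.≤-trans xB≤r (i≤i+1 r)))) , xB≤r

  row-start : A ∈ S → ∃[ l ] (l , yc A) ∈ Upper.path × l ≤ xc A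
  row-start {A} A∈S
    with minimiser-such-that xc (λ C → (yc C ℤ.≟ yc A) ×-dec (xc C ℤ.≤? xc A)) A∈S (refl , ℤ.≤-refl)
  ... | (l , _) , L∈S , (refl , l≤xA) , L-min =
    l , Upper.complete (L∈S , inj₁ λ left∈S → i≰i-1 (L-min _ left∈S (refl , ℤ.≤-trans (i-1≤i l) l≤xA))) , l≤xA

  a1 : A1 S
  a1 A A∈S A≢O with down A ∈? S
  ... | yes down∈S = inj₂ down∈S
  ... | no  down∉S with Lower.predecessor (Lower.complete (A∈S , inj₂ (inj₁ down∉S))) A≢O
  ...   | B , B∈ , B→A with monotoneStep⇒right⊎up B→A
  ...     | inj₁ refl = inj₁ (subst (_∈ S) (sym left∘right) (lower⊆S B∈))
  ...     | inj₂ refl = inj₂ (subst (_∈ S) (sym down∘up) (lower⊆S B∈))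

  right⊎up : B ∈ S → B ≢ (xmax , ymax) → right B ∈ S ⊎ up B ∈ S
  right⊎up {B} B∈S B≢top with up B ∈? S
  ... | yes up∈S = inj₂ up∈S
  ... | no  up∉S with Upper.successor (Upper.complete (B∈S , inj₂ (inj₁ up∉S))) B≢top
  ...   | C , C∈ , B→C with monotoneStep⇒right⊎up B→C
  ...     | inj₁ refl = inj₁ (upper⊆S C∈)
  ...     | inj₂ refl = inj₂ (upper⊆S C∈)

  right-fill : A ∈ S → B ∈ S → xc B < xc A → yc A ≤ yc B → right B ∈ S
  right-fill {A} {B} A∈S B∈S xB<xA yA≤yB =
    let (t , T∈ , yB≤t) = column-top B∈S
        (u , U∈ , t≤u)  = Upper.column-after T∈ (i≤i+1 (xc B)) (i<j⇒i+1≤j (ℤ.<-≤-trans xB<xA (≤xmax A∈S)))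
        (b , D∈ , b≤yA) = column-bottom A∈S
        (v , V∈ , v≤b)  = Lower.column-before D∈
                            (ℤ.≤-trans (Upper.0≤xc T∈) (i≤i+1 (xc B))) (i<j⇒i+1≤j xB<xA)
    in proj₂ convex v u (yc B) (xc B + + 1) (lower⊆S V∈) (upper⊆S U∈)
         (ℤ.≤-trans v≤b (ℤ.≤-trans b≤yA yA≤yB)) (ℤ.≤-trans yB≤t t≤u)

  up-fill : A ∈ S → B ∈ S → xc A ≤ xc B → yc B < yc A → up B ∈ S
  up-fill {A} {B} A∈S B∈S xA≤xB yB<yA =
    let (r , R∈ , xB≤r) = row-end B∈S
        (u , U∈ , r≤u)  = Lower.row-after R∈ (i≤i+1 (yc B)) (i<j⇒i+1≤j (ℤ.<-≤-trans yB<yA (≤ymax A∈S)))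
        (l , L∈ , l≤xA) = row-start A∈S
        (v , V∈ , v≤l)  = Upper.row-before L∈
                            (ℤ.≤-trans (Lower.0≤yc R∈) (i≤i+1 (yc B))) (i<j⇒i+1≤j yB<yA)
    in proj₁ convex v u (xc B) (yc B + + 1) (upper⊆S V∈) (lower⊆S U∈)
         (ℤ.≤-trans v≤l (ℤ.≤-trans l≤xA xA≤xB)) (ℤ.≤-trans xB≤r r≤u)

  a2 : A2 S
  a2 A B A∈S B∈S A⊈B =
      (λ _ _ → right⊎up B∈S λ { refl → A⊈B (≤xmax A∈S , ≤ymax A∈S) })
    , (λ xA≤xB _ → up-fill A∈S B∈S xA≤xB (ℤ.≰⇒> λ yA≤yB → A⊈B (xA≤xB , yA≤yB)))
    , (λ _ yA≤yB → right-fill A∈S B∈S (ℤ.≰⇒> λ xA≤xB → A⊈B (xA≤xB , yA≤yB)) yA≤yB)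

  antimatroidal : Antimatroidal S
  antimatroidal = a1 , a2

-- From the antimatroid axioms to convexity, connectivity and the boundary paths

module _ {S : PointSet} (a2 : A2 S) where

  A2⇒up : A ∈ S → B ∈ S → xc A ≤ xc B → yc B < yc A → up B ∈ S
  A2⇒up A∈S B∈S xA≤xB yB<yA =
    proj₁ (proj₂ (a2 _ _ A∈S B∈S λ (_ , yA≤yB) → ℤ.<⇒≱ yB<yA yA≤yB)) xA≤xB (ℤ.<⇒≤ yB<yA)

  A2⇒right : A ∈ S → B ∈ S → xc B < xc A → yc A ≤ yc B → right B ∈ S
  A2⇒right A∈S B∈S xB<xA yA≤yB =
    proj₂ (proj₂ (a2 _ _ A∈S B∈S λ (xA≤xB , _) → ℤ.<⇒≱ xB<xA xA≤xB)) (ℤ.<⇒≤ xB<xA) yA≤yB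

  column-fill : ∀ {x a} → A ∈ S → (x , a) ∈ S → xc A ≤ x → ∀ {k} → a ≤ k → k ≤ yc A → (x , k) ∈ S
  column-fill {x = x} A∈S start xA≤x {k} =
    interval-induction (λ k → (x , k) ∈ S) start (λ _ k<yA k∈S → A2⇒up A∈S k∈S xA≤x k<yA) k

  row-fill : ∀ {y a} → A ∈ S → (a , y) ∈ S → yc A ≤ y → ∀ {k} → a ≤ k → k ≤ xc A → (k , y) ∈ S
  row-fill {y = y} A∈S start yA≤y {k} =
    interval-induction (λ k → (k , y) ∈ S) start (λ _ k<xA k∈S → A2⇒right A∈S k∈S k<xA yA≤y) k

PathIn : PointSet → Point → Point → Set
PathIn S A B = Σ (List Point) λ P → IsN4Path P × FromTo P A B × AllIn P S

module _ {S : PointSet} where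

  trivial-path : A ∈ S → PathIn S A A
  trivial-path {A} A∈S = A ∷ [] , [-] , (refl , refl) , λ { _ (here refl) → A∈S }

  path-cons : ∀ {C} → N4 A B → A ∈ S → PathIn S B C → PathIn S A C
  path-cons {A} A~B A∈S (B ∷ P , linked , (refl , ends) , inS) =
    A ∷ B ∷ P , A~B ∷ linked , (refl , ends) , λ { _ (here refl) → A∈S ; C (there C∈) → inS C C∈ }

  edge : N4 A B → A ∈ S → B ∈ S → PathIn S A B
  edge A~B A∈S B∈S = path-cons A~B A∈S (trivial-path B∈S)

  path-++ : ∀ {C} → PathIn S A B → PathIn S B C → PathIn S A C
  path-++ (P , linked , from-to , inS) = go P linked from-to inS
    where
    go : ∀ {A B C} P → IsN4Path P → FromTo P A B → AllIn P S → PathIn S B C → PathIn S A C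
    go (A ∷ []) _ (refl , refl) _ Q = Q
    go (A ∷ A′ ∷ P) (A~A′ ∷ linked) (refl , ends) inS Q =
      path-cons A~A′ (inS A (here refl)) (go (A′ ∷ P) linked (refl , ends) (λ C C∈ → inS C (there C∈)) Q)

record Successor (Bd : Point → Set) (A : Point) : Set where
  field
    next    : Point
    step    : MonotoneStep A next
    next∈Bd : Bd next
    least   : ∀ {B} → Bd B → A ⊂ₚ B → next ⊆ₚ B

record BoundaryWalk (Bd : Point → Set) (A E : Point) : Set where
  field
    walk     : List Point
    starts   : head walk ≡ just A
    ends     : last walk ≡ just E
    linked   : Linked MonotoneStep walk
    sound    : ∀ {B} → B ∈ walk → Bd B
    complete : ∀ {B} → Bd B → A ⊆ₚ B → B ∈ walk

module _ {Bd : Point → Set} {E : Point} (below-E : ∀ {B} → Bd B → B ⊆ₚ E)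
         (successor : ∀ {A} → Bd A → A ≢ E → Successor Bd A) where

  private
    extend : Bd A → (s : Successor Bd A) → BoundaryWalk Bd (Successor.next s) E → BoundaryWalk Bd A E
    extend {A} A∈Bd s record { walk = B ∷ W ; starts = refl ; ends = ends ; linked = linked ; sound = sound ; complete = complete } =
      record
        { walk = A ∷ B ∷ W
        ; starts = refl
        ; ends = ends
        ; linked = Successor.step s ∷ linked
        ; sound = λ { (here refl) → A∈Bd ; (there C∈) → sound C∈ }
        ; complete = λ {C} C∈Bd A⊆C → case-on C C∈Bd A⊆C
        }
      where
      case-on : ∀ C → Bd C → A ⊆ₚ C → C ∈ A ∷ B ∷ W
      case-on C C∈Bd A⊆C with C ≟ₚ A
      ... | yes C≡A = here C≡A
      ... | no  C≢A = there (complete C∈Bd (Successor.least s C∈Bd (A⊆C , C≢A ∘ sym)))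

  boundary-walk : ∀ n → Bd A → coordSum A + + n ≡ coordSum E → BoundaryWalk Bd A E
  boundary-walk {A} n A∈Bd sum≡ with A ≟ₚ E
  ... | yes refl = record
    { walk = A ∷ [] ; starts = refl ; ends = refl ; linked = [-]
    ; sound = λ { (here refl) → A∈Bd }
    ; complete = λ B∈Bd A⊆B → here (⊆ₚ-antisym (below-E B∈Bd) A⊆B)
    }
  ... | no A≢E with n
  ...   | zero  = ⊥-elim (ℤ.<-irrefl (trans (sym (ℤ.+-identityʳ _)) sum≡) (coordSum-mono-⊂ (below-E A∈Bd , A≢E)))
  ...   | suc n = extend A∈Bd s (boundary-walk n (Successor.next∈Bd s) next-sum≡)
    where
    s : Successor Bd A
    s = successor A∈Bd A≢E
    shift : ∀ a n → (a + + 1) + n ≡ a + (+ 1 + n)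
    shift = solve-∀
    next-sum≡ : coordSum (Successor.next s) + + n ≡ coordSum E
    next-sum≡ = trans (cong (_+ + n) (coordSum-step (Successor.step s))) (trans (shift (coordSum A) (+ n)) sum≡)

  walk⇒boundaryIsPath : (∀ {B} → Bd B → origin ⊆ₚ B) → BoundaryWalk Bd origin E → BoundaryIsPath Bd E
  walk⇒boundaryIsPath above-origin w =
    walk , (Linked.map monotoneStep⇒<lex linked , λ _ → sound , λ B∈Bd → complete B∈Bd (above-origin B∈Bd)) ,
    linked , starts , ends
    where open BoundaryWalk w

module FromAntimatroid (S : PointSet) {s : Point} (s∈S : s ∈ S) (a1 : A1 S) (a2 : A2 S) where

  private
    leftmost-lowest : ∃[ O ] O ∈ S × (∀ A → A ∈ S → xc O ≤ xc A)
                                   × (∀ A → A ∈ S → xc A ≡ xc O → yc O ≤ yc A)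
    leftmost-lowest =
      let (L , L∈S , L-min)        = minimiser xc s∈S
          (O , O∈S , xO≡ , O-min) = minimiser-such-that yc (λ C → xc C ℤ.≟ xc L) L∈S refl
      in O , O∈S , (λ A A∈S → subst (_≤ xc A) (sym xO≡) (L-min A A∈S))
                 , (λ A A∈S xA≡ → O-min A A∈S (trans xA≡ xO≡))

    lowest-leftmost : ∃[ O ] O ∈ S × (∀ A → A ∈ S → yc O ≤ yc A)
                                   × (∀ A → A ∈ S → yc A ≡ yc O → xc O ≤ xc A)
    lowest-leftmost =
      let (L , L∈S , L-min)        = minimiser yc s∈S
          (O , O∈S , yO≡ , O-min) = minimiser-such-that xc (λ C → yc C ℤ.≟ yc L) L∈S refl
      in O , O∈S , (λ A A∈S → subst (_≤ yc A) (sym yO≡) (L-min A A∈S))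
                 , (λ A A∈S yA≡ → O-min A A∈S (trans yA≡ yO≡))

    no-predecessor⇒origin : A ∈ S → left A ∉ S → down A ∉ S → A ≡ origin
    no-predecessor⇒origin {A} A∈S left∉S down∉S with A ≟ₚ origin
    ... | yes A≡O = A≡O
    ... | no  A≢O with a1 A A∈S A≢O
    ...   | inj₁ left∈S = ⊥-elim (left∉S left∈S)
    ...   | inj₂ down∈S = ⊥-elim (down∉S down∈S)

  origin-leftmost : origin ∈ S × (∀ A → A ∈ S → + 0 ≤ xc A)
  origin-leftmost with leftmost-lowest
  ... | O , O∈S , x-min , y-min
    with no-predecessor⇒origin O∈S (i≰i-1 ∘ x-min _) (λ down∈S → i≰i-1 (y-min _ down∈S refl))
  ... | refl = O∈S , x-min

  origin-lowest : origin ∈ S × (∀ A → A ∈ S → + 0 ≤ yc A)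
  origin-lowest with lowest-leftmost
  ... | O , O∈S , y-min , x-min
    with no-predecessor⇒origin O∈S (λ left∈S → i≰i-1 (x-min _ left∈S refl)) (i≰i-1 ∘ y-min _)
  ... | refl = O∈S , y-min

  origin∈S : origin ∈ S
  origin∈S = proj₁ origin-leftmost

  0≤xc : A ∈ S → + 0 ≤ xc A
  0≤xc = proj₂ origin-leftmost _

  0≤yc : A ∈ S → + 0 ≤ yc A
  0≤yc = proj₂ origin-lowest _

  orthConvex : OrthConvex S
  orthConvex = (λ a b k c A∈S B∈S → row-fill a2 B∈S A∈S ℤ.≤-refl)
             , (λ a b k c A∈S B∈S → column-fill a2 B∈S A∈S ℤ.≤-refl)

  paths-to-origin : ∀ n → A ∈ S → coordSum A ≡ + n → PathIn S A origin × PathIn S origin A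
  paths-to-origin {A} zero A∈S sum≡0 rewrite sum-zero⇒origin (0≤xc A∈S) (0≤yc A∈S) sum≡0 =
    trivial-path origin∈S , trivial-path origin∈S
  paths-to-origin {A} (suc n) A∈S sum≡
    with a1 A A∈S (λ A≡O → coordSum-origin≢suc (subst (λ A → coordSum A ≡ _) A≡O sum≡))
  ... | inj₁ left∈S =
    let (to , from) = paths-to-origin n left∈S (trans (coordSum-left A) (cong (_- + 1) sum≡))
    in path-cons (inj₂ (inj₁ refl)) A∈S to , path-++ from (edge (inj₁ (sym right∘left)) left∈S A∈S)
  ... | inj₂ down∈S =
    let (to , from) = paths-to-origin n down∈S (trans (coordSum-down A) (cong (_- + 1) sum≡))
    in path-cons (inj₂ (inj₂ (inj₂ refl))) A∈S to , path-++ from (edge (inj₂ (inj₂ (inj₁ (sym up∘down)))) down∈S A∈S)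

  coordSum≡+∣coordSum∣ : A ∈ S → coordSum A ≡ + ∣ coordSum A ∣
  coordSum≡+∣coordSum∣ A∈S = 0≤i⇒i≡+∣i∣ (ℤ.+-mono-≤ (0≤xc A∈S) (0≤yc A∈S))

  connected : N4Connected S
  connected A B A∈S B∈S =
    path-++ (proj₁ (paths-to-origin _ A∈S (coordSum≡+∣coordSum∣ A∈S)))
            (proj₂ (paths-to-origin _ B∈S (coordSum≡+∣coordSum∣ B∈S)))

  private
    highest : ∃[ M ] M ∈ S × (∀ B → B ∈ S → coordSum B ≤ coordSum M)
    highest = maximiser coordSum s∈S

  top : Point
  top = proj₁ highest

  top∈S : top ∈ S
  top∈S = proj₁ (proj₂ highest)

  nothing-above-top : MonotoneStep top B → B ∉ S
  nothing-above-top top→B B∈S =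
    i+1≰i (subst (_≤ coordSum top) (coordSum-step top→B) (proj₂ (proj₂ highest) _ B∈S))

  below-top : A ∈ S → A ⊆ₚ top
  below-top {A} A∈S with xc A ℤ.≤? xc top | yc A ℤ.≤? yc top
  ... | yes xA≤ | yes yA≤ = xA≤ , yA≤
  ... | yes xA≤ | no  yA≰ = ⊥-elim (nothing-above-top up-step (A2⇒up a2 A∈S top∈S xA≤ (ℤ.≰⇒> yA≰)))
  ... | no  xA≰ | yes yA≤ = ⊥-elim (nothing-above-top right-step (A2⇒right a2 A∈S top∈S (ℤ.≰⇒> xA≰) yA≤))
  ... | no  xA≰ | no  yA≰ with proj₁ (a2 A top A∈S top∈S (xA≰ ∘ proj₁)) (ℤ.<⇒≤ (ℤ.≰⇒> xA≰)) (ℤ.<⇒≤ (ℤ.≰⇒> yA≰))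
  ...   | inj₁ right∈S = ⊥-elim (nothing-above-top right-step right∈S)
  ...   | inj₂ up∈S    = ⊥-elim (nothing-above-top up-step up∈S)

  top-is-max : ∀ {xm ym} → IsMaxX S xm → IsMaxY S ym → top ≡ (xm , ym)
  top-is-max ((X , X∈S , refl) , ≤xm) ((Y , Y∈S , refl) , ≤ym) =
    ⊆ₚ-antisym (≤xm top top∈S , ≤ym top top∈S) (proj₁ (below-top X∈S) , proj₂ (below-top Y∈S))

  right⊎up : A ∈ S → A ≢ top → right A ∈ S ⊎ up A ∈ S
  right⊎up A∈S A≢top =
    proj₁ (a2 top _ top∈S A∈S λ top⊆A → A≢top (⊆ₚ-antisym (below-top A∈S) top⊆A))
      (proj₁ (below-top A∈S)) (proj₂ (below-top A∈S))

  left-column-below : ∀ n {x y} → y ≡ + n → (x , y) ∈ S → + 0 < x → ∃[ y′ ] y′ ≤ y × (x - + 1 , y′) ∈ S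
  left-column-below n {x} {y} y≡n P∈S 0<x with a1 (x , y) P∈S (λ { refl → ℤ.<-irrefl refl 0<x })
  ... | inj₁ left∈S = y , ℤ.≤-refl , left∈S
  ... | inj₂ down∈S with n
  ...   | zero  = ⊥-elim (i≰i-1 (subst (λ y → + 0 ≤ y - + 1) y≡n (0≤yc down∈S)))
  ...   | suc n =
    let (y′ , y′≤ , Q∈S) = left-column-below n (cong (_- + 1) y≡n) down∈S 0<x
    in y′ , ℤ.≤-trans y′≤ (i-1≤i y) , Q∈S

  row-below-left : ∀ n {x y} → x ≡ + n → (x , y) ∈ S → + 0 < y → ∃[ x′ ] x′ ≤ x × (x′ , y - + 1) ∈ S
  row-below-left n {x} {y} x≡n P∈S 0<y with a1 (x , y) P∈S (λ { refl → ℤ.<-irrefl refl 0<y })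
  ... | inj₂ down∈S = x , ℤ.≤-refl , down∈S
  ... | inj₁ left∈S with n
  ...   | zero  = ⊥-elim (i≰i-1 (subst (λ x → + 0 ≤ x - + 1) x≡n (0≤xc left∈S)))
  ...   | suc n =
    let (x′ , x′≤ , Q∈S) = row-below-left n (cong (_- + 1) x≡n) left∈S 0<y
    in x′ , ℤ.≤-trans x′≤ (i-1≤i x) , Q∈S

  lower-right : ∀ {x y} → InLower S (x , y) → (x + + 1 , y) ∈ S → InLower S (x + + 1 , y)
  lower-right (_   , inj₁ right∉S)           right∈S = ⊥-elim (right∉S right∈S)
  lower-right (_   , inj₂ (inj₂ corner∉S))   right∈S = right∈S , inj₂ (inj₁ corner∉S)
  lower-right {x} {y} (P∈S , inj₂ (inj₁ down∉S)) right∈S = right∈S , inj₂ (inj₁ λ corner∈S →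
    let (y′ , y′≤ , Q∈S) = left-column-below _ (0≤i⇒i≡+∣i∣ (0≤yc corner∈S)) corner∈S
                             (ℤ.≤-<-trans (0≤xc P∈S) (i<i+1 x))
    in down∉S (column-fill a2 P∈S (subst (λ x → (x , y′) ∈ S) (i+1-1≡i x) Q∈S) ℤ.≤-refl y′≤ (i-1≤i y)))

  upper-up : ∀ {x y} → InUpper S (x , y) → (x , y + + 1) ∈ S → InUpper S (x , y + + 1)
  upper-up (_   , inj₂ (inj₁ up∉S))          up∈S = ⊥-elim (up∉S up∈S)
  upper-up (_   , inj₂ (inj₂ corner∉S))      up∈S = up∈S , inj₁ corner∉S
  upper-up {x} {y} (P∈S , inj₁ left∉S) up∈S = up∈S , inj₁ λ corner∈S →
    let (x′ , x′≤ , Q∈S) = row-below-left _ (0≤i⇒i≡+∣i∣ (0≤xc corner∈S)) corner∈S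
                             (ℤ.≤-<-trans (0≤yc P∈S) (i<i+1 y))
    in left∉S (row-fill a2 P∈S (subst (λ y → (x′ , y) ∈ S) (i+1-1≡i y) Q∈S) ℤ.≤-refl x′≤ (i-1≤i x))

  rightless-⊂⇒up⊆ : A ∈ S → right A ∉ S → B ∈ S → A ⊂ₚ B → up A ⊆ₚ B
  rightless-⊂⇒up⊆ A∈S right∉S B∈S A⊂B with ⊂ₚ⇒up⊆⊎beside A⊂B
  ... | inj₁ up⊆B = up⊆B
  ... | inj₂ (yB≡yA , xA<xB) =
    ⊥-elim (right∉S (row-fill a2 B∈S A∈S (ℤ.≤-reflexive yB≡yA) (i≤i+1 _) (i<j⇒i+1≤j xA<xB)))

  upless-⊂⇒right⊆ : A ∈ S → up A ∉ S → B ∈ S → A ⊂ₚ B → right A ⊆ₚ B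
  upless-⊂⇒right⊆ A∈S up∉S B∈S A⊂B with ⊂ₚ⇒right⊆⊎above A⊂B
  ... | inj₁ right⊆B = right⊆B
  ... | inj₂ (xB≡xA , yA<yB) =
    ⊥-elim (up∉S (column-fill a2 B∈S A∈S (ℤ.≤-reflexive xB≡xA) (i≤i+1 _) (i<j⇒i+1≤j yA<yB)))

  -- If B lay in the column of A, filling the columns of A and right A would put
  -- all three neighbours that make B a lower boundary point into S.
  lower-⊂⇒right⊆ : A ∈ S → right A ∈ S → InLower S B → A ⊂ₚ B → right A ⊆ₚ B
  lower-⊂⇒right⊆ {A} {xB , yB} A∈S right∈S (B∈S , B-boundary) A⊂B with ⊂ₚ⇒right⊆⊎above A⊂B
  ... | inj₁ right⊆B = right⊆B
  ... | inj₂ (refl , yA<yB) with B-boundary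
  ...   | inj₁ right∉S         = ⊥-elim (right∉S (column-fill a2 B∈S right∈S (i≤i+1 _) (ℤ.<⇒≤ yA<yB) ℤ.≤-refl))
  ...   | inj₂ (inj₁ down∉S)   = ⊥-elim (down∉S (column-fill a2 B∈S A∈S ℤ.≤-refl (i<j⇒i≤j-1 yA<yB) (i-1≤i yB)))
  ...   | inj₂ (inj₂ corner∉S) = ⊥-elim (corner∉S (column-fill a2 B∈S right∈S (i≤i+1 _) (i<j⇒i≤j-1 yA<yB) (i-1≤i yB)))

  upper-⊂⇒up⊆ : A ∈ S → up A ∈ S → InUpper S B → A ⊂ₚ B → up A ⊆ₚ B
  upper-⊂⇒up⊆ {A} {xB , yB} A∈S up∈S (B∈S , B-boundary) A⊂B with ⊂ₚ⇒up⊆⊎beside A⊂B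
  ... | inj₁ up⊆B = up⊆B
  ... | inj₂ (refl , xA<xB) with B-boundary
  ...   | inj₁ left∉S          = ⊥-elim (left∉S (row-fill a2 B∈S A∈S ℤ.≤-refl (i<j⇒i≤j-1 xA<xB) (i-1≤i xB)))
  ...   | inj₂ (inj₁ up∉S)     = ⊥-elim (up∉S (row-fill a2 B∈S up∈S (i≤i+1 _) (ℤ.<⇒≤ xA<xB) ℤ.≤-refl))
  ...   | inj₂ (inj₂ corner∉S) = ⊥-elim (corner∉S (row-fill a2 B∈S up∈S (i≤i+1 _) (i<j⇒i≤j-1 xA<xB) (i-1≤i xB)))

  lower-successor : InLower S A → A ≢ top → Successor (InLower S) A
  lower-successor {A} A∈L@(A∈S , _) A≢top with right A ∈? S
  ... | yes right∈S = record
    { next = right A ; step = right-step ; next∈Bd = lower-right A∈L right∈S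
    ; least = lower-⊂⇒right⊆ A∈S right∈S }
  ... | no right∉S = record
    { next = up A ; step = up-step
    ; next∈Bd = up∈S , inj₂ (inj₂ (right∉S ∘ subst (λ y → (xc A + + 1 , y) ∈ S) (i+1-1≡i (yc A))))
    ; least = λ B∈L → rightless-⊂⇒up⊆ A∈S right∉S (proj₁ B∈L) }
    where
    up∈S : up A ∈ S
    up∈S with right⊎up A∈S A≢top
    ... | inj₁ right∈S = ⊥-elim (right∉S right∈S)
    ... | inj₂ up∈S    = up∈S

  upper-successor : InUpper S A → A ≢ top → Successor (InUpper S) A
  upper-successor {A} A∈U@(A∈S , _) A≢top with up A ∈? S
  ... | yes up∈S = record
    { next = up A ; step = up-step ; next∈Bd = upper-up A∈U up∈S
    ; least = upper-⊂⇒up⊆ A∈S up∈S }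
  ... | no up∉S = record
    { next = right A ; step = right-step
    ; next∈Bd = right∈S , inj₂ (inj₂ (up∉S ∘ subst (λ x → (x , yc A + + 1) ∈ S) (i+1-1≡i (xc A))))
    ; least = λ B∈U → upless-⊂⇒right⊆ A∈S up∉S (proj₁ B∈U) }
    where
    right∈S : right A ∈ S
    right∈S with right⊎up A∈S A≢top
    ... | inj₁ right∈S = right∈S
    ... | inj₂ up∈S    = ⊥-elim (up∉S up∈S)

  bounded : BoundedByTwoMonotonePaths S
  bounded = origin∈S , λ xm ym isMaxX isMaxY →
    subst (λ E → BoundaryIsPath (InLower S) E × BoundaryIsPath (InUpper S) E) (top-is-max isMaxX isMaxY)
      ( walk⇒boundaryIsPath (below-top ∘ proj₁) lower-successor (above-origin ∘ proj₁)
          (boundary-walk (below-top ∘ proj₁) lower-successor _ origin∈Lower (sym (coordSum≡+∣coordSum∣ top∈S)))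
      , walk⇒boundaryIsPath (below-top ∘ proj₁) upper-successor (above-origin ∘ proj₁)
          (boundary-walk (below-top ∘ proj₁) upper-successor _ origin∈Upper (sym (coordSum≡+∣coordSum∣ top∈S))))
    where
    above-origin : A ∈ S → origin ⊆ₚ A
    above-origin A∈S = 0≤xc A∈S , 0≤yc A∈S
    origin∈Lower : InLower S origin
    origin∈Lower = origin∈S , inj₂ (inj₁ (i≰i-1 ∘ 0≤yc))
    origin∈Upper : InUpper S origin
    origin∈Upper = origin∈S , inj₁ (i≰i-1 ∘ 0≤xc)

theorem1 : (S : PointSet) → S ≢ [] →
    Antimatroidal S ⇔ (OrthConvex S × N4Connected S × BoundedByTwoMonotonePaths S)
theorem1 []      S≢[] = ⊥-elim (S≢[] refl)
theorem1 (s ∷ S) _    = mk⇔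
  (λ (a1 , a2) → let open FromAntimatroid (s ∷ S) (here refl) a1 a2 in orthConvex , connected , bounded)
  (λ (convex , _ , bounded) → FromBoundaries.antimatroidal (s ∷ S) (here refl) convex bounded)
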